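{- Let $p$ be a positive integer and let $n$ be an odd integer with $n\ge (2p+2)^2$. Suppose further that if $n\equiv 3\pmod 6$ then $p\equiv 1\pmod 3$. Then there exists an integer $\alpha$ satisfying $2p+2\le \alpha\le n-2-2p$, $\gcd(n,\alpha)=1$, $\gcd(n,\alpha-2p-1)=1$ and $\gcd(n,n-1-\alpha-2p)=1$. -}

module Defs where

module Submission where

-- Write m = 2p + 1 and T = α - m.  The three integers of the theorem are then
-- α - m = T, α = T + m and n - 1 - α - 2p = n - (T + 2m), so it suffices to find
-- T ≥ 1 with T + 2m < n such that n is coprime to the three terms
-- T, T + m, T + 2m of an arithmetic progression of difference m.
--
-- To find T, split n = A·B where every prime factor of A divides m and B is
-- coprime to m (the m-smooth part and its cofactor).  Because n is odd and
-- (3 ∣ n → 3 ∣ m), the cofactor B is also coprime to 2 and 3.  Any x with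
-- x ≡ ±B (mod m) is coprime to A, and it is coprime to B as soon as
-- x ≡ c·m (mod B) with c coprime to B.  Choosing T = 2m - B (when B < 2m, c = 2,3,4),
-- T = m + B (when A ≥ 3, c = 1,2,3) or T = m (when A = 1, so n = B) gives the
-- progression; the size bound n ≥ (2p+2)² > 4m makes each choice fit below n.

open import Defs
open import Data.Product using (∃; _×_; _,_)
open import Relation.Nullary using (¬_)
open import Relation.Binary.PropositionalEquality using (_≡_; refl; sym; trans; cong; subst; subst₂; module ≡-Reasoning)

module Progression where

  open import Data.Nat
  open import Data.Nat.Properties
  open import Data.Nat.Divisibility
  open import Data.Nat.GCD using (gcd; gcd[m,n]∣m; gcd[m,n]∣n; gcd[m,n]≢0)
  open import Data.Nat.Coprimality
    using (Coprime; gcd≡1⇒coprime; coprime-divisor; 1-coprimeTo)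
    renaming (sym to coprime-sym)
  open import Data.Nat.Primality using (Irreducible; irreducible[2]; irreducible?)
  open import Data.Nat.Induction using (<-rec)
  open import Data.Nat.Tactic.RingSolver using (solve-∀)
  open import Data.Sum using (_⊎_; inj₁; inj₂)
  open import Relation.Nullary using (yes; no; contradiction)
  open import Relation.Nullary.Decidable using (from-yes)

  coprime-transfer : ∀ {m x y} → (∀ {d} → d ∣ m → d ∣ x → d ∣ y) → Coprime m y → Coprime m x
  coprime-transfer common m⊥y (d∣m , d∣x) = m⊥y (d∣m , common d∣m d∣x)

  coprime-divisorˡ : ∀ {a b z} → a ∣ b → Coprime b z → Coprime a z
  coprime-divisorˡ a∣b b⊥z (d∣a , d∣z) = b⊥z (∣-trans d∣a a∣b , d∣z)

  coprime-*ˡ : ∀ {a b z} → Coprime a z → Coprime b z → Coprime (a * b) z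
  coprime-*ˡ {a} {b} {z} a⊥z b⊥z {d} (d∣ab , d∣z) = b⊥z (coprime-divisor d⊥a d∣ab , d∣z)
    where
    d⊥a : Coprime d a
    d⊥a (i∣d , i∣a) = a⊥z (i∣a , ∣-trans i∣d d∣z)

  coprime-*ʳ : ∀ {a b z} → Coprime z a → Coprime z b → Coprime z (a * b)
  coprime-*ʳ z⊥a z⊥b = coprime-sym (coprime-*ˡ (coprime-sym z⊥a) (coprime-sym z⊥b))

  coprime-complement : ∀ {n x y} → x + y ≡ n → Coprime n x → Coprime n y
  coprime-complement {x = x} {y} x+y≡n = coprime-transfer λ d∣n d∣y →
    ∣m+n∣m⇒∣n (subst (_ ∣_) (trans (sym x+y≡n) (+-comm x y)) d∣n) d∣y

  coprime-irreducible : ∀ {q n} → Irreducible q → ¬ q ∣ n → Coprime n q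
  coprime-irreducible irr q∤n (d∣n , d∣q) with irr d∣q
  ... | inj₁ d≡1 = d≡1
  ... | inj₂ refl = contradiction d∣n q∤n

  irreducible[3] : Irreducible 3
  irreducible[3] = from-yes (irreducible? 3)

  -- a is m-smooth: every prime factor of a divides m, phrased without primes as
  -- "every number coprime to m is coprime to a".
  Smooth : ℕ → ℕ → Set
  Smooth m a = ∀ {z} → Coprime m z → Coprime a z

  record Factorisation (m n : ℕ) : Set where
    constructor factorisation
    field
      smoothPart coprimePart : ℕ
      factorises : n ≡ smoothPart * coprimePart
      smooth : Smooth m smoothPart
      coprime : Coprime coprimePart m

  coprime-or-common-factor : ∀ m n → NonZero n → Coprime n m ⊎ NonTrivial (gcd n m)
  coprime-or-common-factor m n n≢0 with gcd n m in g≡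
  ... | 0    = contradiction g≡ (gcd[m,n]≢0 n m (inj₁ (≢-nonZero⁻¹ n {{n≢0}})))
  ... | 1    = inj₁ (gcd≡1⇒coprime g≡)
  ... | 2+ _ = inj₂ _

  -- Every positive n has such a factorisation: divide out gcd(n, m) until what is
  -- left is coprime to m (strong induction on n).
  factorise : ∀ m n → NonZero n → Factorisation m n
  factorise m = <-rec (λ n → NonZero n → Factorisation m n) step
    where
    step : ∀ n → (∀ {k} → k < n → NonZero k → Factorisation m k) →
           NonZero n → Factorisation m n
    step n rec n≢0 with coprime-or-common-factor m n n≢0
    ... | inj₁ n⊥m = factorisation 1 n (sym (*-identityˡ n)) (λ _ → 1-coprimeTo _) n⊥m
    ... | inj₂ g-nontrivial = factorisation (a * g) b n≡agb ag-smooth b⊥m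
      where
      g : ℕ
      g = gcd n m
      g∣n : g ∣ n
      g∣n = gcd[m,n]∣m n m
      instance
        _ = n≢0
        _ = g-nontrivial
      open Factorisation (rec (quotient-< g∣n) (quotient≢0 g∣n))
        renaming (smoothPart to a; coprimePart to b; factorises to q≡ab;
                  smooth to a-smooth; coprime to b⊥m)
      n≡agb : n ≡ a * g * b
      n≡agb = begin
        n                ≡⟨ _∣_.equality g∣n ⟩
        quotient g∣n * g ≡⟨ cong (_* g) q≡ab ⟩
        a * b * g        ≡⟨ *-assoc a b g ⟩
        a * (b * g)      ≡⟨ cong (a *_) (*-comm b g) ⟩
        a * (g * b)      ≡⟨ *-assoc a g b ⟨
        a * g * b        ∎
        where open ≡-Reasoning
      ag-smooth : Smooth m (a * g)
      ag-smooth m⊥z = coprime-*ˡ (a-smooth m⊥z) (coprime-divisorˡ (gcd[m,n]∣n n m) m⊥z)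

  -- A nonzero odd number has no factor 0 or 2.
  odd-factor : ∀ {n} a {b} → NonZero n → ¬ 2 ∣ n → n ≡ a * b → a ≡ 1 ⊎ 3 ≤ a
  odd-factor {n} 0 n≢0 _ n≡0 = contradiction n≡0 (≢-nonZero⁻¹ n {{n≢0}})
  odd-factor 1 _ _ _ = inj₁ refl
  odd-factor 2 {b} _ 2∤n n≡2b = contradiction (divides b (trans n≡2b (*-comm 2 b))) 2∤n
  odd-factor (suc (suc (suc _))) _ _ _ = inj₂ (s≤s (s≤s (s≤s z≤n)))

  record Admissible (M N T : ℕ) : Set where
    field
      positive : 0 < T
      bounded  : T + M + M < N
      coprime₀ : Coprime N T
      coprime₁ : Coprime N (T + M)
      coprime₂ : Coprime N (T + M + M)

  module Construction {M N A B : ℕ} (N≡AB : N ≡ A * B) (A-smooth : Smooth M A)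
    (B⊥M : Coprime B M) (B⊥2 : Coprime B 2) (B⊥3 : Coprime B 3)
    (0<M : 0 < M) (4M<N : 4 * M < N) (2∤N : ¬ 2 ∣ N) where

    N≢0 : NonZero N
    N≢0 = >-nonZero (≤-trans (s≤s z≤n) 4M<N)

    0<B : 0 < B
    0<B = n≢0⇒n>0 λ B≡0 →
      ≢-nonZero⁻¹ N {{N≢0}} (trans N≡AB (trans (cong (A *_) B≡0) (*-zeroʳ A)))

    B⊥1 : Coprime B 1
    B⊥1 = coprime-sym (1-coprimeTo B)

    B⊥4 : Coprime B 4
    B⊥4 = coprime-*ʳ B⊥2 B⊥2

    coprime-N : ∀ {x} → Coprime M x → Coprime B x → Coprime N x
    coprime-N {x} M⊥x B⊥x =
      subst (λ k → Coprime k x) (sym N≡AB) (coprime-*ˡ (A-smooth M⊥x) B⊥x)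

    coprime-below : ∀ {x} c → x + B ≡ c * M → Coprime B c → Coprime N x
    coprime-below {x} c x+B≡cM B⊥c = coprime-N M⊥x B⊥x
      where
      M⊥x : Coprime M x
      M⊥x = coprime-transfer (λ {d} d∣M d∣x →
        ∣m+n∣m⇒∣n (subst (d ∣_) (sym x+B≡cM) (∣n⇒∣m*n c d∣M)) d∣x) (coprime-sym B⊥M)
      B⊥x : Coprime B x
      B⊥x = coprime-transfer (λ {d} d∣B d∣x →
        subst (d ∣_) x+B≡cM (∣m∣n⇒∣m+n d∣x d∣B)) (coprime-*ʳ B⊥c B⊥M)

    coprime-above : ∀ {x} c → x ≡ c * M + B → Coprime B c → Coprime N x
    coprime-above {x} c x≡cM+B B⊥c = coprime-N M⊥x B⊥x
      where
      M⊥x : Coprime M x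
      M⊥x = coprime-transfer (λ {d} d∣M d∣x →
        ∣m+n∣m⇒∣n (subst (d ∣_) x≡cM+B d∣x) (∣n⇒∣m*n c d∣M)) (coprime-sym B⊥M)
      B⊥x : Coprime B x
      B⊥x = coprime-transfer (λ {d} d∣B d∣x →
        ∣m+n∣m⇒∣n (subst (d ∣_) (trans x≡cM+B (+-comm (c * M) B)) d∣x) d∣B)
        (coprime-*ʳ B⊥c B⊥M)

    step-below : ∀ {x} c → x + B ≡ c * M → x + M + B ≡ suc c * M
    step-below {x} c x+B≡cM = begin
      x + M + B   ≡⟨ swap x M B ⟩
      x + B + M   ≡⟨ cong (_+ M) x+B≡cM ⟩
      c * M + M   ≡⟨ +-comm (c * M) M ⟩
      suc c * M   ∎
      where
      open ≡-Reasoning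
      swap : ∀ x m b → x + m + b ≡ x + b + m
      swap = solve-∀

    step-above : ∀ {x} c → x ≡ c * M + B → x + M ≡ suc c * M + B
    step-above {x} c x≡cM+B = begin
      x + M         ≡⟨ cong (_+ M) x≡cM+B ⟩
      c * M + B + M ≡⟨ swap (c * M) B M ⟩
      suc c * M + B ∎
      where
      open ≡-Reasoning
      swap : ∀ a b m → a + b + m ≡ m + a + b
      swap = solve-∀

    -- B < 2M: take T = 2M - B, so that T + jM + B = (2 + j)M.
    admissible-below : B < 2 * M → ∃ (Admissible M N)
    admissible-below B<2M = T , record
      { positive = m<n⇒0<n∸m B<2M
      ; bounded  = <-trans (subst (T + M + M <_) T+2M+B≡4M (m<m+n (T + M + M) 0<B)) 4M<N
      ; coprime₀ = coprime-below 2 T+B≡2M B⊥2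
      ; coprime₁ = coprime-below 3 T+M+B≡3M B⊥3
      ; coprime₂ = coprime-below 4 T+2M+B≡4M B⊥4
      }
      where
      T : ℕ
      T = 2 * M ∸ B
      T+B≡2M : T + B ≡ 2 * M
      T+B≡2M = m∸n+n≡m (<⇒≤ B<2M)
      T+M+B≡3M : T + M + B ≡ 3 * M
      T+M+B≡3M = step-below 2 T+B≡2M
      T+2M+B≡4M : T + M + M + B ≡ 4 * M
      T+2M+B≡4M = step-below 3 T+M+B≡3M

    -- A = 1, so N = B: take T = M, whose progression consists of M, 2M and 3M.
    admissible-free : A ≡ 1 → ∃ (Admissible M N)
    admissible-free refl = M , record
      { positive = 0<M
      ; bounded  = <-trans (subst (M + M + M <_) (four M) (m<m+n (M + M + M) 0<M)) 4M<N
      ; coprime₀ = coprime-N-free (sym (*-identityˡ M)) B⊥1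
      ; coprime₁ = coprime-N-free (two M) B⊥2
      ; coprime₂ = coprime-N-free (three M) B⊥3
      }
      where
      coprime-N-free : ∀ {x c} → x ≡ c * M → Coprime B c → Coprime N x
      coprime-N-free x≡cM B⊥c =
        subst₂ Coprime (sym (trans N≡AB (*-identityˡ B))) (sym x≡cM) (coprime-*ʳ B⊥c B⊥M)
      two : ∀ m → m + m ≡ 2 * m
      two = solve-∀
      three : ∀ m → m + m + m ≡ 3 * m
      three = solve-∀
      four : ∀ m → m + m + m + m ≡ 4 * m
      four = solve-∀

    -- A ≥ 3 and B ≥ 2M: take T = M + B, so that T + jM = (1 + j)M + B.
    admissible-above : 3 ≤ A → 2 * M ≤ B → ∃ (Admissible M N)
    admissible-above 3≤A 2M≤B = M + B , record
      { positive = <-≤-trans 0<M (m≤m+n M B)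
      ; bounded  = bounded
      ; coprime₀ = coprime-above 1 T≡M+B B⊥1
      ; coprime₁ = coprime-above 2 T+M≡2M+B B⊥2
      ; coprime₂ = coprime-above 3 (step-above 2 T+M≡2M+B) B⊥3
      }
      where
      T≡M+B : M + B ≡ 1 * M + B
      T≡M+B = cong (_+ B) (sym (*-identityˡ M))
      T+M≡2M+B : M + B + M ≡ 2 * M + B
      T+M≡2M+B = step-above 1 T≡M+B
      bounded : M + B + M + M < N
      bounded = begin-strict
        M + B + M + M   ≡⟨ rearrange M B ⟩
        B + 3 * M       <⟨ +-monoʳ-< B (subst (3 * M <_) (four M) (m<m+n (3 * M) 0<M)) ⟩
        B + 2 * (2 * M) ≤⟨ +-monoʳ-≤ B (*-monoʳ-≤ 2 2M≤B) ⟩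
        B + 2 * B       ≡⟨ triple B ⟩
        3 * B           ≤⟨ *-monoˡ-≤ B 3≤A ⟩
        A * B           ≡⟨ N≡AB ⟨
        N               ∎
        where
        open ≤-Reasoning
        rearrange : ∀ m b → m + b + m + m ≡ b + 3 * m
        rearrange = solve-∀
        four : ∀ m → 3 * m + m ≡ 2 * (2 * m)
        four = solve-∀
        triple : ∀ b → b + 2 * b ≡ 3 * b
        triple = solve-∀

    admissible : ∃ (Admissible M N)
    admissible with B <? 2 * M | odd-factor A N≢0 2∤N N≡AB
    ... | yes B<2M | _          = admissible-below B<2M
    ... | no _     | inj₁ A≡1   = admissible-free A≡1
    ... | no B≮2M  | inj₂ 3≤A   = admissible-above 3≤A (≮⇒≥ B≮2M)

  admissible-exists : ∀ {M N} → 0 < M → 4 * M < N → ¬ 2 ∣ N → (3 ∣ N → 3 ∣ M) →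
                      ∃ (Admissible M N)
  admissible-exists {M} {N} 0<M 4M<N 2∤N 3∣N⇒3∣M =
    Construction.admissible N≡AB A-smooth B⊥M B⊥2 B⊥3 0<M 4M<N 2∤N
    where
    open Factorisation (factorise M N (>-nonZero (≤-trans (s≤s z≤n) 4M<N)))
      renaming (smoothPart to A; coprimePart to B; factorises to N≡AB;
                smooth to A-smooth; coprime to B⊥M)
    B∣N : B ∣ N
    B∣N = divides A N≡AB
    B⊥2 : Coprime B 2
    B⊥2 = coprime-irreducible irreducible[2] λ 2∣B → 2∤N (∣-trans 2∣B B∣N)
    B⊥3 : Coprime B 3
    B⊥3 = coprime-irreducible irreducible[3] λ 3∣B →
      contradiction (B⊥M (3∣B , 3∣N⇒3∣M (∣-trans 3∣B B∣N))) λ ()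

  even-or-odd : ∀ n → ∃ λ j → n ≡ 2 * j ⊎ n ≡ 2 * j + 1
  even-or-odd zero = 0 , inj₁ refl
  even-or-odd (suc n) with even-or-odd n
  ... | j , inj₁ refl = j , inj₂ (+-comm 1 (2 * j))
  ... | j , inj₂ refl = suc j , inj₁ (next j)
    where
    next : ∀ j → suc (2 * j + 1) ≡ 2 * suc j
    next = solve-∀

  odd-multiple-of-three : ∀ {n} → ¬ 2 ∣ n → 3 ∣ n → ∃ λ j → n ≡ 6 * j + 3
  odd-multiple-of-three {n} 2∤n (divides q n≡q*3) with even-or-odd q
  ... | j , inj₁ refl = contradiction (divides (3 * j) (trans n≡q*3 (even j))) 2∤n
    where
    even : ∀ j → 2 * j * 3 ≡ 3 * j * 2
    even = solve-∀
  ... | j , inj₂ refl = j , trans n≡q*3 (odd j)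
    where
    odd : ∀ j → (2 * j + 1) * 3 ≡ 6 * j + 3
    odd = solve-∀

  four-M<square : ∀ P → 0 < P → 4 * (2 * P + 1) < (2 * P + 2) * (2 * P + 2)
  four-M<square P@(suc _) _ = subst (4 * (2 * P + 1) <_) (sym (square P)) (m<m+n _ (s≤s z≤n))
    where
    square : ∀ p → (2 * p + 2) * (2 * p + 2) ≡ 4 * (2 * p + 1) + 4 * (p * p)
    square = solve-∀

  three-divides-M : ∀ {P} → 3 ∣ P → 3 ∣ 2 * suc P + 1
  three-divides-M {P} 3∣P = subst (3 ∣_) (shift P) (∣m∣n⇒∣m+n (∣n⇒∣m*n 2 3∣P) ∣-refl)
    where
    shift : ∀ p → 2 * p + 3 ≡ 2 * suc p + 1
    shift = solve-∀

open import Data.Integer using (ℤ; +_; -[1+_]; _+_; _-_; _*_; _≤_; +≤+)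
open import Data.Integer.Divisibility using (_∣_)
open import Data.Integer.GCD using (gcd)
open import Data.Integer.Properties using (i≤i+j; drop‿+≤+)
open import Data.Integer.Tactic.RingSolver using (solve-∀)
import Data.Nat as ℕ
open import Data.Nat.Properties using (m≤n⇒∃[o]m+o≡n; +-suc; <-≤-trans)
open import Data.Nat.Divisibility using (m∣m*n) renaming (_∣_ to _∣ℕ_)
open import Data.Nat.Coprimality using (Coprime; coprime⇒gcd≡1)
open Progression
  using (Admissible; admissible-exists; coprime-complement; odd-multiple-of-three;
         four-M<square; three-divides-M)

Witness : ℤ → ℤ → ℤ → Set
Witness p n α = (+ 2 * p + + 2 ≤ α) × (α ≤ n - + 2 - + 2 * p)
  × (gcd n α ≡ + 1) × (gcd n (α - + 2 * p - + 1) ≡ + 1)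
  × (gcd n (n - + 1 - α - + 2 * p) ≡ + 1)

gcd≡1 : ∀ {N x} (i : ℤ) → i ≡ + x → Coprime N x → gcd (+ N) i ≡ + 1
gcd≡1 _ refl N⊥x = cong +_ (coprime⇒gcd≡1 N⊥x)

-- An admissible start T for m = 2p + 1 yields the witness α = T + m.  Writing
-- T = 1 + t and n = T + 2m + 1 + r, every quantity of the conclusion is a
-- polynomial identity in p, t, r.
integer-witness : ∀ P {N} → ∃ (Admissible (2 ℕ.* ℕ.suc P ℕ.+ 1) N) →
                  ∃ (Witness (+ ℕ.suc P) (+ N))
integer-witness P (ℕ.zero , record { positive = () })
integer-witness P (ℕ.suc t , admissible) with m≤n⇒∃[o]m+o≡n (Admissible.bounded admissible)
... | r , refl =
  α ,
  subst (+ 2 * p + + 2 ≤_) (sym (α-lower p (+ t))) (i≤i+j _ (+ t)) ,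
  subst (α ≤_) (sym (α-upper p (+ t) (+ r))) (i≤i+j α (+ r)) ,
  gcd≡1 α refl coprime₁ ,
  gcd≡1 _ (α-shifted p (+ t)) coprime₀ ,
  gcd≡1 _ (α-reflected p (+ t) (+ r))
    (coprime-complement (+-suc (ℕ.suc t ℕ.+ M ℕ.+ M) r) coprime₂)
  where
  open Admissible admissible
  M : ℕ.ℕ
  M = 2 ℕ.* ℕ.suc P ℕ.+ 1
  p α : ℤ
  p = + ℕ.suc P
  α = + (ℕ.suc t ℕ.+ M)
  α-lower : ∀ p t → + 1 + t + (+ 2 * p + + 1) ≡ + 2 * p + + 2 + t
  α-lower = solve-∀
  α-upper : ∀ p t r → let m = + 2 * p + + 1 in
            + 1 + (+ 1 + t + m + m) + r - + 2 - + 2 * p ≡ + 1 + t + m + r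
  α-upper = solve-∀
  α-shifted : ∀ p t → + 1 + t + (+ 2 * p + + 1) - + 2 * p - + 1 ≡ + 1 + t
  α-shifted = solve-∀
  α-reflected : ∀ p t r → let m = + 2 * p + + 1 in
                + 1 + (+ 1 + t + m + m) + r - + 1 - (+ 1 + t + m) - + 2 * p ≡ + 1 + r
  α-reflected = solve-∀

mainTheorem9 : (p n : ℤ) → + 1 ≤ p → ¬ (+ 2 ∣ n)
    → (+ 2 * p + + 2) * (+ 2 * p + + 2) ≤ n
    → (+ 6 ∣ n - + 3 → + 3 ∣ p - + 1)
    → ∃ λ (α : ℤ) → (+ 2 * p + + 2 ≤ α) × (α ≤ n - + 2 - + 2 * p)
        × (gcd n α ≡ + 1) × (gcd n (α - + 2 * p - + 1) ≡ + 1)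
        × (gcd n (n - + 1 - α - + 2 * p) ≡ + 1)
mainTheorem9 -[1+ _ ] _ () _ _ _
mainTheorem9 (+ ℕ.zero) _ (+≤+ ()) _ _ _
mainTheorem9 (+ ℕ.suc P) -[1+ _ ] _ _ () _
mainTheorem9 (+ ℕ.suc P) (+ N) _ 2∤N square≤N 6∣n-3⇒3∣p-1 =
  integer-witness P (admissible-exists (ℕ.s≤s ℕ.z≤n) 4M<N 2∤N 3∣N⇒3∣M)
  where
  4M<N : 4 ℕ.* (2 ℕ.* ℕ.suc P ℕ.+ 1) ℕ.< N
  4M<N = <-≤-trans (four-M<square (ℕ.suc P) (ℕ.s≤s ℕ.z≤n)) (drop‿+≤+ square≤N)
  -- If 3 ∣ n then n ≡ 3 (mod 6), so the congruence hypothesis gives 3 ∣ p - 1.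
  3∣N⇒3∣M : 3 ∣ℕ N → 3 ∣ℕ 2 ℕ.* ℕ.suc P ℕ.+ 1
  3∣N⇒3∣M 3∣N with odd-multiple-of-three 2∤N 3∣N
  ... | j , refl = three-divides-M (6∣n-3⇒3∣p-1 6∣n-3)
    where
    cancel : ∀ i → i + + 3 - + 3 ≡ i
    cancel = solve-∀
    6∣n-3 : + 6 ∣ + N - + 3
    6∣n-3 = subst (+ 6 ∣_) (sym (cancel (+ (6 ℕ.* j)))) (m∣m*n j)
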